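{- For every precubical set $C$, the fundamental groupoid $\Pi_1(C)$ is the free groupoid on the fundamental category $\vec\Pi_1(C)$, via the canonical functor $\vec\Pi_1(C)\to\Pi_1(C)$ sending the dihomotopy class of a directed path to its homotopy class.
   Context: A precubical set $C$ has vertices $C(0)$, edges $C(1)$ (an edge $a$ goes from $\partial^-_0a$ to $\partial^+_0a$), squares $C(2)$, etc., with face maps $\partial^\epsilon_i$ satisfying the precubical identities. For a square $\alpha$ put $a=\partial^-_0\alpha$, $b=\partial^+_1\alpha$, $b'=\partial^-_1\alpha$, $a'=\partial^+_0\alpha$. A directed path is a sequence of composable edges; a path is a sequence of composable edges and reversed edges ($\bar a:y\to x$ for $a:x\to y$). Let $\bowtie$ be the smallest symmetric relation on length-2 paths with $a\cdot b\bowtie b'\cdot a'$, $\bar b\cdot\bar a\bowtie\bar{a'}\cdot\bar{b'}$, $\bar a\cdot b'\bowtie b\cdot\bar{a'}$, $\bar{b'}\cdot a\bowtie a'\cdot\bar b$ for every square. Dihomotopy: smallest congruence for concatenation containing $\bowtie$. Homotopy: smallest congruence containing dihomotopy and relating $a\cdot\bar a$ to the empty path at $x$ and $\bar a\cdot a$ to the empty path at $y$ for each edge $a:x\to y$. The fundamental category $\vec\Pi_1(C)$ has vertices as objects and directed paths modulo dihomotopy as morphisms; the fundamental groupoid $\Pi_1(C)$ has vertices as objects and paths modulo homotopy as morphisms. -}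

module Defs where

open import Level using (Level; _⊔_; 0ℓ) renaming (suc to lsuc)
open import Data.Nat using (ℕ; zero; suc; _≤_)
open import Data.Fin using (Fin; zero; suc; toℕ; inject₁)
open import Data.List using (List; []; _∷_; _++_; map)
open import Data.List.Properties using (++-assoc; ++-identityʳ; map-++)
open import Data.Product using (Σ; _,_; proj₁; proj₂)
open import Relation.Binary.PropositionalEquality using (_≡_; refl; sym; trans; cong; subst)

data Sign : Set where
  minus plus : Sign

record PreCubical : Set₁ where
  field
    cell : ℕ → Set
    face : ∀ {n} → Fin (suc n) → Sign → cell (suc n) → cell n
    -- precubical identities: ∂^ε_i ∂^η_j = ∂^η_{j-1} ∂^ε_i  for i < j
    cubical : ∀ {n} (i j : Fin (suc n)) → toℕ i ≤ toℕ j → ∀ ε η (x : cell (suc (suc n))) →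
              face i ε (face (suc j) η x) ≡ face j η (face (inject₁ i) ε x)

module _ (C : PreCubical) where
  open PreCubical C

  Vert : Set
  Vert = cell 0

  Edge : Set
  Edge = cell 1

  Square : Set
  Square = cell 2

  src tgt : Edge → Vert
  src a = face zero minus a
  tgt a = face zero plus a

  sqa sqb sqb' sqa' : Square → Edge
  sqa  α = face zero minus α
  sqb  α = face (suc zero) plus α
  sqb' α = face (suc zero) minus α
  sqa' α = face zero plus α

  data Step : Set where
    fwd : Edge → Step
    bwd : Edge → Step

  start end : Step → Vert
  start (fwd a) = src a
  start (bwd a) = tgt a
  end (fwd a) = tgt a
  end (bwd a) = src a

  data IsPath : Vert → Vert → List Step → Set where
    nil  : ∀ {x} → IsPath x x []
    cons : ∀ {x y} s {p} → start s ≡ x → IsPath (end s) y p → IsPath x y (s ∷ p)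

  data IsDPath : Vert → Vert → List Edge → Set where
    nil  : ∀ {x} → IsDPath x x []
    cons : ∀ {x y} a {p} → src a ≡ x → IsDPath (tgt a) y p → IsDPath x y (a ∷ p)

  data Bowtie : List Step → List Step → Set where
    bt₁ : ∀ α → Bowtie (fwd (sqa α) ∷ fwd (sqb α) ∷ []) (fwd (sqb' α) ∷ fwd (sqa' α) ∷ [])
    bt₂ : ∀ α → Bowtie (bwd (sqb α) ∷ bwd (sqa α) ∷ []) (bwd (sqa' α) ∷ bwd (sqb' α) ∷ [])
    bt₃ : ∀ α → Bowtie (bwd (sqa α) ∷ fwd (sqb' α) ∷ []) (fwd (sqb α) ∷ bwd (sqa' α) ∷ [])
    bt₄ : ∀ α → Bowtie (bwd (sqb' α) ∷ fwd (sqa α) ∷ []) (fwd (sqa' α) ∷ bwd (sqb α) ∷ [])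
    bt-sym : ∀ {p q} → Bowtie p q → Bowtie q p

  data Dihom : List Step → List Step → Set where
    gen    : ∀ {p q} → Bowtie p q → Dihom p q
    d-refl : ∀ {p} → Dihom p p
    d-sym  : ∀ {p q} → Dihom p q → Dihom q p
    d-trans : ∀ {p q r} → Dihom p q → Dihom q r → Dihom p r
    d-cong : ∀ {p p' q q'} → Dihom p p' → Dihom q q' → Dihom (p ++ q) (p' ++ q')

  data Htpy : List Step → List Step → Set where
    dih    : ∀ {p q} → Dihom p q → Htpy p q
    cancelᶠ : ∀ a → Htpy (fwd a ∷ bwd a ∷ []) []
    cancelᵇ : ∀ a → Htpy (bwd a ∷ fwd a ∷ []) []
    h-refl : ∀ {p} → Htpy p p
    h-sym  : ∀ {p q} → Htpy p q → Htpy q p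
    h-trans : ∀ {p q r} → Htpy p q → Htpy q r → Htpy p r
    h-cong : ∀ {p p' q q'} → Htpy p p' → Htpy q q' → Htpy (p ++ q) (p' ++ q')

record Category (o h e : Level) : Set (lsuc (o ⊔ h ⊔ e)) where
  infixr 9 _∘_
  infix 4 _≈_
  field
    Obj : Set o
    Hom : Obj → Obj → Set h
    _≈_ : ∀ {x y} → Hom x y → Hom x y → Set e
    id  : ∀ {x} → Hom x x
    _∘_ : ∀ {x y z} → Hom y z → Hom x y → Hom x z
    ≈-refl  : ∀ {x y} {f : Hom x y} → f ≈ f
    ≈-sym   : ∀ {x y} {f g : Hom x y} → f ≈ g → g ≈ f
    ≈-trans : ∀ {x y} {f g k : Hom x y} → f ≈ g → g ≈ k → f ≈ k
    ∘-resp-≈ : ∀ {x y z} {f f' : Hom y z} {g g' : Hom x y} → f ≈ f' → g ≈ g' → f ∘ g ≈ f' ∘ g'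
    assoc : ∀ {w x y z} {f : Hom w x} {g : Hom x y} {k : Hom y z} → (k ∘ g) ∘ f ≈ k ∘ (g ∘ f)
    identityˡ : ∀ {x y} {f : Hom x y} → id ∘ f ≈ f
    identityʳ : ∀ {x y} {f : Hom x y} → f ∘ id ≈ f

record Groupoid (o h e : Level) : Set (lsuc (o ⊔ h ⊔ e)) where
  field
    category : Category o h e
  open Category category
  field
    _⁻¹ : ∀ {x y} → Hom x y → Hom y x
    inverseˡ : ∀ {x y} {f : Hom x y} → (f ⁻¹) ∘ f ≈ id
    inverseʳ : ∀ {x y} {f : Hom x y} → f ∘ (f ⁻¹) ≈ id

record FunctorOn {o h e o' h' e'} (A : Category o h e) (B : Category o' h' e')
                 (F₀ : Category.Obj A → Category.Obj B) : Set (o ⊔ h ⊔ e ⊔ h' ⊔ e') where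
  private
    module A = Category A
    module B = Category B
  field
    F₁ : ∀ {x y} → A.Hom x y → B.Hom (F₀ x) (F₀ y)
    F-resp : ∀ {x y} {f g : A.Hom x y} → f A.≈ g → F₁ f B.≈ F₁ g
    F-id : ∀ {x} → F₁ (A.id {x}) B.≈ B.id
    F-∘ : ∀ {x y z} {f : A.Hom x y} {g : A.Hom y z} → F₁ (g A.∘ f) B.≈ (F₁ g B.∘ F₁ f)

record Functor {o h e o' h' e'} (A : Category o h e) (B : Category o' h' e')
               : Set (o ⊔ h ⊔ e ⊔ o' ⊔ h' ⊔ e') where
  field
    F₀ : Category.Obj A → Category.Obj B
    isFunctor : FunctorOn A B F₀
  open FunctorOn isFunctor public

module _ (C : PreCubical) where

  ++-path : ∀ {x y z p q} → IsPath C x y p → IsPath C y z q → IsPath C x z (p ++ q)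
  ++-path nil hq = hq
  ++-path (cons s e hp) hq = cons s e (++-path hp hq)

  ++-dpath : ∀ {x y z p q} → IsDPath C x y p → IsDPath C y z q → IsDPath C x z (p ++ q)
  ++-dpath nil hq = hq
  ++-dpath (cons s e hp) hq = cons s e (++-dpath hp hq)

  ≡⇒Htpy : ∀ {p q} → p ≡ q → Htpy C p q
  ≡⇒Htpy refl = h-refl

  ≡⇒Dihom : ∀ {p q} → p ≡ q → Dihom C p q
  ≡⇒Dihom refl = d-refl

  flip : Step C → Step C
  flip (fwd a) = bwd a
  flip (bwd a) = fwd a

  rev : List (Step C) → List (Step C)
  rev [] = []
  rev (s ∷ p) = rev p ++ (flip s ∷ [])

  flip-end : ∀ s → start C (flip s) ≡ end C s
  flip-end (fwd a) = refl
  flip-end (bwd a) = refl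

  flip-start : ∀ s → end C (flip s) ≡ start C s
  flip-start (fwd a) = refl
  flip-start (bwd a) = refl

  rev-path : ∀ {x y p} → IsPath C x y p → IsPath C y x (rev p)
  rev-path nil = nil
  rev-path (cons s refl hp) =
    ++-path (rev-path hp) (cons (flip s) (flip-end s) (subst (λ v → IsPath C v (start C s) []) (sym (flip-start s)) nil))

  cancel : ∀ s → Htpy C (s ∷ flip s ∷ []) []
  cancel (fwd a) = cancelᶠ a
  cancel (bwd a) = cancelᵇ a

  cancel' : ∀ s → Htpy C (flip s ∷ s ∷ []) []
  cancel' (fwd a) = cancelᵇ a
  cancel' (bwd a) = cancelᶠ a

  rev-r : ∀ p → Htpy C (p ++ rev p) []
  rev-r [] = h-refl
  rev-r (s ∷ p) =
    h-trans (≡⇒Htpy (cong (s ∷_) (sym (++-assoc p (rev p) (flip s ∷ [])))))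
      (h-trans (h-cong {p = s ∷ []} h-refl (h-cong (rev-r p) (h-refl {p = flip s ∷ []})))
               (cancel s))

  rev-l : ∀ p → Htpy C (rev p ++ p) []
  rev-l [] = h-refl
  rev-l (s ∷ p) =
    h-trans (≡⇒Htpy (++-assoc (rev p) (flip s ∷ []) (s ∷ p)))
      (h-trans (h-cong {p = rev p} h-refl
                 (h-trans (h-cong {p = flip s ∷ s ∷ []} {q = p} (cancel' s) h-refl) h-refl))
               (rev-l p))

  FundCat : Category 0ℓ 0ℓ 0ℓ
  FundCat = record
    { Obj = Vert C
    ; Hom = λ x y → Σ (List (Edge C)) (IsDPath C x y)
    ; _≈_ = λ p q → Dihom C (map (fwd {C}) (proj₁ p)) (map fwd (proj₁ q))
    ; id = [] , nil
    ; _∘_ = λ g f → (proj₁ f ++ proj₁ g) , ++-dpath (proj₂ f) (proj₂ g)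
    ; ≈-refl = d-refl
    ; ≈-sym = d-sym
    ; ≈-trans = d-trans
    ; ∘-resp-≈ = λ {_} {_} {_} {f} {f'} {g} {g'} e₁ e₂ →
        d-trans (≡⇒Dihom (map-++ fwd (proj₁ g) (proj₁ f)))
          (d-trans (d-cong e₂ e₁) (≡⇒Dihom (sym (map-++ fwd (proj₁ g') (proj₁ f')))))
    ; assoc = λ {_} {_} {_} {_} {f} {g} {k} → ≡⇒Dihom (cong (map fwd) (sym (++-assoc (proj₁ f) (proj₁ g) (proj₁ k))))
    ; identityˡ = λ {_} {_} {f} → ≡⇒Dihom (cong (map fwd) (++-identityʳ (proj₁ f)))
    ; identityʳ = d-refl
    }

  FundGpd : Groupoid 0ℓ 0ℓ 0ℓ
  FundGpd = record
    { category = record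
      { Obj = Vert C
      ; Hom = λ x y → Σ (List (Step C)) (IsPath C x y)
      ; _≈_ = λ p q → Htpy C (proj₁ p) (proj₁ q)
      ; id = [] , nil
      ; _∘_ = λ g f → (proj₁ f ++ proj₁ g) , ++-path (proj₂ f) (proj₂ g)
      ; ≈-refl = h-refl
      ; ≈-sym = h-sym
      ; ≈-trans = h-trans
      ; ∘-resp-≈ = λ e₁ e₂ → h-cong e₂ e₁
      ; assoc = λ {_} {_} {_} {_} {f} {g} {k} → ≡⇒Htpy (sym (++-assoc (proj₁ f) (proj₁ g) (proj₁ k)))
      ; identityˡ = λ {_} {_} {f} → ≡⇒Htpy (++-identityʳ (proj₁ f))
      ; identityʳ = h-refl
      }
    ; _⁻¹ = λ f → rev (proj₁ f) , rev-path (proj₂ f)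
    ; inverseˡ = λ {_} {_} {f} → rev-r (proj₁ f)
    ; inverseʳ = λ {_} {_} {f} → rev-l (proj₁ f)
    }

  dpath⇒path : ∀ {x y p} → IsDPath C x y p → IsPath C x y (map fwd p)
  dpath⇒path nil = nil
  dpath⇒path (cons a e hp) = cons (fwd a) e (dpath⇒path hp)

  canonical : Functor FundCat (Groupoid.category FundGpd)
  canonical = record
    { F₀ = λ x → x
    ; isFunctor = record
      { F₁ = λ p → map fwd (proj₁ p) , dpath⇒path (proj₂ p)
      ; F-resp = dih
      ; F-id = h-refl
      ; F-∘ = λ {_} {_} {_} {f} {g} → ≡⇒Htpy (map-++ fwd (proj₁ f) (proj₁ g))
      }
    }

{-# OPTIONS --safe #-}
-- On a path the extension of F is forced: a backward edge must go to the inverse of the image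
-- of the edge. The difficulty is that homotopy relates arbitrary lists of steps, most of which
-- are not paths, so the evaluation of paths cannot be shown homotopy-invariant directly.
-- Instead every list of steps becomes a word of morphisms of G with unrelated endpoints, and
-- words are compared by the rewriting system that composes composable neighbours and drops
-- identities. It shortens words, so by Newman's lemma it is confluent modulo ≈. Cancellation,
-- the square relations and hence homotopy are all conversions of words, and by confluence two
-- one-letter words are convertible only if their letters are equal, so homotopic paths
-- evaluate to equal morphisms.
module Submission where

open import Defs
open import Level using (Level; _⊔_)
open import Data.Empty using (⊥-elim)
open import Data.Fin using (zero; suc)
open import Data.Nat using (zero; suc; z≤n)
open import Data.Nat.Properties using (suc-injective; 1+n≢0)
open import Data.List using (List; []; _∷_; _++_; [_]; map; length)
open import Data.List.Properties using (map-++)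
open import Data.List.Relation.Binary.Pointwise as Pointwise using (Pointwise; []; _∷_)
open import Data.Product using (Σ; _×_; _,_; proj₂)
open import Relation.Binary.Bundles using (Setoid)
open import Relation.Binary.Construct.Closure.ReflexiveTransitive using (Star; ε; _◅_; _◅◅_; gmap)
open import Relation.Binary.PropositionalEquality using (_≡_; refl; sym; trans; cong; subst; subst₂)
import Relation.Binary.Reasoning.Setoid as SetoidReasoning

module FormalComposites {o ℓ e : Level} (𝒞 : Category o ℓ e) where
  open Category 𝒞

  infix 4 _≈ₐ_ _≋_ _⟶_ _⟶*_ _∼_

  data Arrow : Set (o ⊔ ℓ) where
    ⟨_⟩ : ∀ {A B} → Hom A B → Arrow

  Word : Set (o ⊔ ℓ)
  Word = List Arrow

  private
    variable
      A B : Obj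
      L M N L' M' M₁ M₂ : Word

  data _≈ₐ_ : Arrow → Arrow → Set (o ⊔ ℓ ⊔ e) where
    ⟨_⟩ : {g g' : Hom A B} → g ≈ g' → ⟨ g ⟩ ≈ₐ ⟨ g' ⟩

  ≈ₐ-refl : ∀ {x} → x ≈ₐ x
  ≈ₐ-refl {⟨ g ⟩} = ⟨ ≈-refl ⟩

  ≈ₐ-sym : ∀ {x y} → x ≈ₐ y → y ≈ₐ x
  ≈ₐ-sym ⟨ p ⟩ = ⟨ ≈-sym p ⟩

  ≈ₐ-trans : ∀ {x y z} → x ≈ₐ y → y ≈ₐ z → x ≈ₐ z
  ≈ₐ-trans ⟨ p ⟩ ⟨ q ⟩ = ⟨ ≈-trans p q ⟩

  _≋_ : Word → Word → Set (o ⊔ ℓ ⊔ e)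
  _≋_ = Pointwise _≈ₐ_

  ≋-refl : L ≋ L
  ≋-refl = Pointwise.refl ≈ₐ-refl

  ≋-sym : L ≋ M → M ≋ L
  ≋-sym = Pointwise.symmetric ≈ₐ-sym

  ≋-trans : L ≋ M → M ≋ N → L ≋ N
  ≋-trans = Pointwise.transitive ≈ₐ-trans

  data _⟶_ : Word → Word → Set (o ⊔ ℓ ⊔ e) where
    merge   : ∀ {C} (g : Hom A B) (h : Hom B C) R → ⟨ g ⟩ ∷ ⟨ h ⟩ ∷ R ⟶ ⟨ h ∘ g ⟩ ∷ R
    drop-id : {g : Hom A A} (R : Word) → g ≈ id → ⟨ g ⟩ ∷ R ⟶ R
    there   : ∀ x → L ⟶ M → x ∷ L ⟶ x ∷ M

  _⟶*_ : Word → Word → Set (o ⊔ ℓ ⊔ e)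
  _⟶*_ = Star _⟶_

  ⟶-shrinks : L ⟶ M → length L ≡ suc (length M)
  ⟶-shrinks (merge g h R) = refl
  ⟶-shrinks (drop-id R p) = refl
  ⟶-shrinks (there x m)   = cong suc (⟶-shrinks m)

  ⟶-++ʳ : ∀ R → L ⟶ M → L ++ R ⟶ M ++ R
  ⟶-++ʳ R (merge g h R') = merge g h (R' ++ R)
  ⟶-++ʳ R (drop-id R' p) = drop-id (R' ++ R) p
  ⟶-++ʳ R (there x m)    = there x (⟶-++ʳ R m)

  ⟶-++ˡ : ∀ P → L ⟶ M → P ++ L ⟶ P ++ M
  ⟶-++ˡ []      m = m
  ⟶-++ˡ (x ∷ P) m = there x (⟶-++ˡ P m)

  ≋-simulates-⟶ : L ≋ L' → L ⟶ M → Σ Word λ M' → L' ⟶ M' × M ≋ M'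
  ≋-simulates-⟶ (⟨ p ⟩ ∷ ⟨ q ⟩ ∷ r) (merge g h R) = _ , merge _ _ _ , ⟨ ∘-resp-≈ q p ⟩ ∷ r
  ≋-simulates-⟶ (⟨ p ⟩ ∷ r) (drop-id R g≈id)      = _ , drop-id _ (≈-trans (≈-sym p) g≈id) , r
  ≋-simulates-⟶ (p ∷ r) (there x m) with ≋-simulates-⟶ r m
  ... | M' , m' , r' = _ , there _ m' , p ∷ r'

  ≋-simulates-⟶* : L ≋ L' → L ⟶* M → Σ Word λ M' → L' ⟶* M' × M ≋ M'
  ≋-simulates-⟶* q ε = _ , ε , q
  ≋-simulates-⟶* q (m ◅ ms) with ≋-simulates-⟶ q m
  ... | _ , m' , q' with ≋-simulates-⟶* q' ms
  ...   | _ , ms' , q'' = _ , m' ◅ ms' , q''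

  record Joinable (X Y : Word) : Set (o ⊔ ℓ ⊔ e) where
    constructor join
    field
      {X' Y'} : Word
      reduceˡ : X ⟶* X'
      reduceʳ : Y ⟶* Y'
      equiv   : X' ≋ Y'

  joinable-refl : Joinable L L
  joinable-refl = join ε ε ≋-refl

  joinable-sym : Joinable L M → Joinable M L
  joinable-sym (join l r q) = join r l (≋-sym q)

  joinable-there : ∀ x → Joinable L M → Joinable (x ∷ L) (x ∷ M)
  joinable-there x (join l r q) = join (gmap (x ∷_) (there x) l) (gmap (x ∷_) (there x) r) (≈ₐ-refl ∷ q)

  merge-peak : ∀ {C} (g : Hom A B) (h : Hom B C) R →
               ⟨ g ⟩ ∷ ⟨ h ⟩ ∷ R ⟶ M → Joinable (⟨ h ∘ g ⟩ ∷ R) M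
  merge-peak g h R (merge _ _ _) = joinable-refl
  merge-peak g h R (drop-id _ g≈id) =
    join ε ε (⟨ ≈-trans (∘-resp-≈ ≈-refl g≈id) identityʳ ⟩ ∷ ≋-refl)
  merge-peak g h R (there _ (merge _ _ _)) =
    join (merge _ _ _ ◅ ε) (merge _ _ _ ◅ ε) (⟨ ≈-sym assoc ⟩ ∷ ≋-refl)
  merge-peak g h R (there _ (drop-id _ h≈id)) =
    join ε ε (⟨ ≈-trans (∘-resp-≈ h≈id ≈-refl) identityˡ ⟩ ∷ ≋-refl)
  merge-peak g h R (there _ (there _ m)) = join (there _ m ◅ ε) (merge _ _ _ ◅ ε) ≋-refl

  drop-id-peak : {g : Hom A A} (R : Word) → g ≈ id → ⟨ g ⟩ ∷ R ⟶ M → Joinable R M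
  drop-id-peak R g≈id (merge _ h _) =
    join ε ε (⟨ ≈-sym (≈-trans (∘-resp-≈ ≈-refl g≈id) identityʳ) ⟩ ∷ ≋-refl)
  drop-id-peak R g≈id (drop-id _ _) = joinable-refl
  drop-id-peak R g≈id (there _ m)   = join (m ◅ ε) (drop-id _ g≈id ◅ ε) ≋-refl

  ⟶-locallyConfluent : L ⟶ M₁ → L ⟶ M₂ → Joinable M₁ M₂
  ⟶-locallyConfluent (merge g h R) m              = merge-peak g h R m
  ⟶-locallyConfluent (drop-id R g≈id) m           = drop-id-peak R g≈id m
  ⟶-locallyConfluent (there x m) (merge g h R)    = joinable-sym (merge-peak g h R (there x m))
  ⟶-locallyConfluent (there x m) (drop-id R g≈id) = joinable-sym (drop-id-peak R g≈id (there x m))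
  ⟶-locallyConfluent (there x m) (there _ m')     = joinable-there x (⟶-locallyConfluent m m')

  -- Newman's lemma modulo ≋, by induction on the length of the word.
  ⟶*-confluent : L ⟶* M₁ → L ⟶* M₂ → Joinable M₁ M₂
  ⟶*-confluent = confluentAt _ refl
    where
    shorter : ∀ {n} → L ⟶ M → length L ≡ suc n → length M ≡ n
    shorter m eq = suc-injective (trans (sym (⟶-shrinks m)) eq)

    confluentAt : ∀ n {L M₁ M₂} → length L ≡ n → L ⟶* M₁ → L ⟶* M₂ → Joinable M₁ M₂
    confluentAt n _ ε ms = join ms ε ≋-refl
    confluentAt n _ (m ◅ ms) ε = join ε (m ◅ ms) ≋-refl
    confluentAt zero eq (m ◅ _) (_ ◅ _) = ⊥-elim (1+n≢0 (trans (sym (⟶-shrinks m)) eq))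
    confluentAt (suc n) eq (m₁ ◅ ms₁) (m₂ ◅ ms₂)
      with join k₁ k₂ N₁≋N₂ ← ⟶-locallyConfluent m₁ m₂
      with join a p A≋P ← confluentAt n (shorter m₁ eq) ms₁ k₁
      with _ , p' , P≋P' ← ≋-simulates-⟶* N₁≋N₂ p
      with join q b Q≋B ← confluentAt n (shorter m₂ eq) (k₂ ◅◅ p') ms₂
      with _ , q' , Q≋Q' ← ≋-simulates-⟶* (≋-sym (≋-trans A≋P P≋P')) q
      = join (a ◅◅ q') b (≋-trans (≋-sym Q≋Q') Q≋B)

  joinable-trans : Joinable L M → Joinable M N → Joinable L N
  joinable-trans (join l₁ r₁ q₁) (join l₂ r₂ q₂)
    with join a b q ← ⟶*-confluent r₁ l₂
    with _ , a' , q₁' ← ≋-simulates-⟶* (≋-sym q₁) a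
    with _ , b' , q₂' ← ≋-simulates-⟶* q₂ b
    = join (l₁ ◅◅ a') (r₂ ◅◅ b') (≋-trans (≋-sym q₁') (≋-trans q q₂'))

  data _∼_ : Word → Word → Set (o ⊔ ℓ ⊔ e) where
    ⟶⇒∼    : L ⟶ M → L ∼ M
    ≋⇒∼    : L ≋ M → L ∼ M
    ∼-sym   : L ∼ M → M ∼ L
    ∼-trans : L ∼ M → M ∼ N → L ∼ N

  ∼-refl : L ∼ L
  ∼-refl = ≋⇒∼ ≋-refl

  ∼-setoid : Setoid (o ⊔ ℓ) (o ⊔ ℓ ⊔ e)
  ∼-setoid = record
    { Carrier = Word
    ; _≈_ = _∼_
    ; isEquivalence = record { refl = ∼-refl ; sym = ∼-sym ; trans = ∼-trans }
    }

  ∼-++ʳ : ∀ R → L ∼ M → L ++ R ∼ M ++ R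
  ∼-++ʳ R (⟶⇒∼ m)       = ⟶⇒∼ (⟶-++ʳ R m)
  ∼-++ʳ R (≋⇒∼ q)       = ≋⇒∼ (Pointwise.++⁺ q ≋-refl)
  ∼-++ʳ R (∼-sym p)     = ∼-sym (∼-++ʳ R p)
  ∼-++ʳ R (∼-trans p q) = ∼-trans (∼-++ʳ R p) (∼-++ʳ R q)

  ∼-++ˡ : ∀ P → L ∼ M → P ++ L ∼ P ++ M
  ∼-++ˡ P (⟶⇒∼ m)       = ⟶⇒∼ (⟶-++ˡ P m)
  ∼-++ˡ P (≋⇒∼ q)       = ≋⇒∼ (Pointwise.++⁺ ≋-refl q)
  ∼-++ˡ P (∼-sym p)     = ∼-sym (∼-++ˡ P p)
  ∼-++ˡ P (∼-trans p q) = ∼-trans (∼-++ˡ P p) (∼-++ˡ P q)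

  ∼-++ : L ∼ L' → M ∼ M' → L ++ M ∼ L' ++ M'
  ∼-++ {L' = L'} {M = M} p q = ∼-trans (∼-++ʳ M p) (∼-++ˡ L' q)

  ∼-cong : ∀ P R → L ∼ M → P ++ L ++ R ∼ P ++ M ++ R
  ∼-cong P R p = ∼-++ˡ P (∼-++ʳ R p)

  ∼⇒joinable : L ∼ M → Joinable L M
  ∼⇒joinable (⟶⇒∼ m)       = join (m ◅ ε) ε ≋-refl
  ∼⇒joinable (≋⇒∼ q)       = join ε ε q
  ∼⇒joinable (∼-sym p)     = joinable-sym (∼⇒joinable p)
  ∼⇒joinable (∼-trans p q) = joinable-trans (∼⇒joinable p) (∼⇒joinable q)

  ∼-singleton⇒≈ : {g g' : Hom A B} → [ ⟨ g ⟩ ] ∼ [ ⟨ g' ⟩ ] → g ≈ g'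
  ∼-singleton⇒≈ p with ∼⇒joinable p
  ... | join ε ε (⟨ q ⟩ ∷ []) = q
  ... | join (drop-id _ g≈id ◅ ε) (drop-id _ g'≈id ◅ ε) [] = ≈-trans g≈id (≈-sym g'≈id)
  ... | join (drop-id _ _ ◅ () ◅ _) _ _
  ... | join _ (drop-id _ _ ◅ () ◅ _) _
  ... | join ε (drop-id _ _ ◅ ε) ()
  ... | join (drop-id _ _ ◅ ε) ε ()
  ... | join (there _ () ◅ _) _ _
  ... | join _ (there _ () ◅ _) _

module GroupoidWords {o ℓ e : Level} (G : Groupoid o ℓ e) where
  open Groupoid G using (_⁻¹; inverseˡ; inverseʳ)
  open Category (Groupoid.category G)
  open FormalComposites (Groupoid.category G)
  open SetoidReasoning ∼-setoid

  private
    variable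
      A B C D A' B' C' D' : Obj

  ⁻¹-unique : {f : Hom A B} {g : Hom B A} → g ∘ f ≈ id → g ≈ f ⁻¹
  ⁻¹-unique g∘f≈id = ≈-trans (≈-sym identityʳ)
    (≈-trans (∘-resp-≈ ≈-refl (≈-sym inverseʳ))
    (≈-trans (≈-sym assoc) (≈-trans (∘-resp-≈ g∘f≈id ≈-refl) identityˡ)))

  ⁻¹-resp-≈ : {f g : Hom A B} → f ≈ g → f ⁻¹ ≈ g ⁻¹
  ⁻¹-resp-≈ f≈g = ⁻¹-unique (≈-trans (∘-resp-≈ ≈-refl (≈-sym f≈g)) inverseˡ)

  cancelʳ : {f : Hom A B} → ⟨ f ⟩ ∷ ⟨ f ⁻¹ ⟩ ∷ [] ∼ []
  cancelʳ = ∼-trans (⟶⇒∼ (merge _ _ [])) (⟶⇒∼ (drop-id [] inverseˡ))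

  cancelˡ : {f : Hom A B} → ⟨ f ⁻¹ ⟩ ∷ ⟨ f ⟩ ∷ [] ∼ []
  cancelˡ = ∼-trans (⟶⇒∼ (merge _ _ [])) (⟶⇒∼ (drop-id [] inverseʳ))

  -- The letters need not be composable: only cancellation of f f⁻¹ is used.
  ∼-transpose : {f : Hom A B} {g : Hom A' B'} {h : Hom C D} {k : Hom C' D'} →
                ⟨ f ⟩ ∷ ⟨ g ⟩ ∷ [] ∼ ⟨ h ⟩ ∷ ⟨ k ⟩ ∷ [] →
                ⟨ f ⁻¹ ⟩ ∷ ⟨ h ⟩ ∷ [] ∼ ⟨ g ⟩ ∷ ⟨ k ⁻¹ ⟩ ∷ []
  ∼-transpose {f = f} {g} {h} {k} fg∼hk = begin
    ⟨ f ⁻¹ ⟩ ∷ ⟨ h ⟩ ∷ []                     ≈⟨ ∼-cong (⟨ f ⁻¹ ⟩ ∷ ⟨ h ⟩ ∷ []) [] (∼-sym (cancelʳ {f = k})) ⟩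
    ⟨ f ⁻¹ ⟩ ∷ ⟨ h ⟩ ∷ ⟨ k ⟩ ∷ ⟨ k ⁻¹ ⟩ ∷ []  ≈⟨ ∼-cong [ ⟨ f ⁻¹ ⟩ ] [ ⟨ k ⁻¹ ⟩ ] (∼-sym fg∼hk) ⟩
    ⟨ f ⁻¹ ⟩ ∷ ⟨ f ⟩ ∷ ⟨ g ⟩ ∷ ⟨ k ⁻¹ ⟩ ∷ []  ≈⟨ ∼-cong [] (⟨ g ⟩ ∷ ⟨ k ⁻¹ ⟩ ∷ []) cancelˡ ⟩
    ⟨ g ⟩ ∷ ⟨ k ⁻¹ ⟩ ∷ []                     ∎

  ∼-inverse : {f : Hom A B} {g : Hom A' B'} {h : Hom C D} {k : Hom C' D'} →
              ⟨ f ⟩ ∷ ⟨ g ⟩ ∷ [] ∼ ⟨ h ⟩ ∷ ⟨ k ⟩ ∷ [] →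
              ⟨ g ⁻¹ ⟩ ∷ ⟨ f ⁻¹ ⟩ ∷ [] ∼ ⟨ k ⁻¹ ⟩ ∷ ⟨ h ⁻¹ ⟩ ∷ []
  ∼-inverse {f = f} {g} {h} {k} fg∼hk = begin
    ⟨ g ⁻¹ ⟩ ∷ ⟨ f ⁻¹ ⟩ ∷ []
      ≈⟨ ∼-cong (⟨ g ⁻¹ ⟩ ∷ ⟨ f ⁻¹ ⟩ ∷ []) [] (∼-sym (cancelʳ {f = h})) ⟩
    ⟨ g ⁻¹ ⟩ ∷ ⟨ f ⁻¹ ⟩ ∷ ⟨ h ⟩ ∷ ⟨ h ⁻¹ ⟩ ∷ []
      ≈⟨ ∼-cong (⟨ g ⁻¹ ⟩ ∷ ⟨ f ⁻¹ ⟩ ∷ ⟨ h ⟩ ∷ []) [ ⟨ h ⁻¹ ⟩ ] (∼-sym (cancelʳ {f = k})) ⟩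
    ⟨ g ⁻¹ ⟩ ∷ ⟨ f ⁻¹ ⟩ ∷ ⟨ h ⟩ ∷ ⟨ k ⟩ ∷ ⟨ k ⁻¹ ⟩ ∷ ⟨ h ⁻¹ ⟩ ∷ []
      ≈⟨ ∼-cong (⟨ g ⁻¹ ⟩ ∷ ⟨ f ⁻¹ ⟩ ∷ []) (⟨ k ⁻¹ ⟩ ∷ ⟨ h ⁻¹ ⟩ ∷ []) (∼-sym fg∼hk) ⟩
    ⟨ g ⁻¹ ⟩ ∷ ⟨ f ⁻¹ ⟩ ∷ ⟨ f ⟩ ∷ ⟨ g ⟩ ∷ ⟨ k ⁻¹ ⟩ ∷ ⟨ h ⁻¹ ⟩ ∷ []
      ≈⟨ ∼-cong [ ⟨ g ⁻¹ ⟩ ] (⟨ g ⟩ ∷ ⟨ k ⁻¹ ⟩ ∷ ⟨ h ⁻¹ ⟩ ∷ []) cancelˡ ⟩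
    ⟨ g ⁻¹ ⟩ ∷ ⟨ g ⟩ ∷ ⟨ k ⁻¹ ⟩ ∷ ⟨ h ⁻¹ ⟩ ∷ []
      ≈⟨ ∼-cong [] (⟨ k ⁻¹ ⟩ ∷ ⟨ h ⁻¹ ⟩ ∷ []) cancelˡ ⟩
    ⟨ k ⁻¹ ⟩ ∷ ⟨ h ⁻¹ ⟩ ∷ []
      ∎

module FreeExtension (C : PreCubical) {o ℓ e : Level} (G : Groupoid o ℓ e)
                     (F : Functor (FundCat C) (Groupoid.category G)) where
  open PreCubical C using (face; cubical)
  open Groupoid G using (_⁻¹)
  open Category (Groupoid.category G)
  open FormalComposites (Groupoid.category G)
  open GroupoidWords G
  open Functor F using (F₀; F₁; F-resp; F-id; F-∘)

  private
    module Π₁ = Category (Groupoid.category (FundGpd C))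
    module Π⃗₁ = Category (FundCat C)
    variable
      x y z : Vert C
      p q : List (Step C)

  stepHom : (s : Step C) → Hom (F₀ (start C s)) (F₀ (end C s))
  stepHom (fwd a) = F₁ ([ a ] , cons a refl nil)
  stepHom (bwd a) = stepHom (fwd a) ⁻¹

  word : List (Step C) → Word
  word = map (λ s → ⟨ stepHom s ⟩)

  eval : IsPath C x y p → Hom (F₀ x) (F₀ y)
  eval nil               = id
  eval (cons s refl hp) = eval hp ∘ stepHom s

  word∼eval : (hp : IsPath C x y p) → word p ∼ [ ⟨ eval hp ⟩ ]
  word∼eval nil              = ∼-sym (⟶⇒∼ (drop-id [] ≈-refl))
  word∼eval (cons s refl hp) =
    ∼-trans (∼-++ˡ [ ⟨ stepHom s ⟩ ] (word∼eval hp)) (⟶⇒∼ (merge _ _ []))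

  eval-++ : (hp : IsPath C x y p) (hq : IsPath C y z q) → eval (++-path C hp hq) ≈ eval hq ∘ eval hp
  eval-++ nil              hq = ≈-sym identityʳ
  eval-++ (cons s refl hp) hq = ≈-trans (∘-resp-≈ (eval-++ hp hq) ≈-refl) assoc

  eval-dpath : ∀ {ds} (hp : IsDPath C x y ds) → eval (dpath⇒path C hp) ≈ F₁ (ds , hp)
  eval-dpath nil              = ≈-sym F-id
  eval-dpath (cons a refl hp) = ≈-trans (∘-resp-≈ (eval-dpath hp) ≈-refl) (≈-sym F-∘)

  dword∼F₁ : ∀ {ds} (hp : IsDPath C x y ds) → word (map fwd ds) ∼ [ ⟨ F₁ (ds , hp) ⟩ ]
  dword∼F₁ hp = ∼-trans (word∼eval (dpath⇒path C hp)) (≋⇒∼ (⟨ eval-dpath hp ⟩ ∷ []))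

  module Square (α : Square C) where
    a b b' a' : Edge C
    a  = sqa C α
    b  = sqb C α
    b' = sqb' C α
    a' = sqa' C α

    corner : ∀ σ τ → face zero σ (face (suc zero) τ α) ≡ face zero τ (face zero σ α)
    corner σ τ = cubical zero zero z≤n σ τ α

    lower : IsDPath C (src C a) (tgt C b) (a ∷ b ∷ [])
    lower = cons a refl (cons b (corner minus plus) nil)

    upper : IsDPath C (src C a) (tgt C b) (b' ∷ a' ∷ [])
    upper = cons b' (corner minus minus) (cons a' (sym (corner plus minus))
              (subst (λ v → IsDPath C (tgt C a') v []) (sym (corner plus plus)) nil))

    commutes : word (fwd a ∷ fwd b ∷ []) ∼ word (fwd b' ∷ fwd a' ∷ [])
    commutes = ∼-trans (dword∼F₁ lower)
      (∼-trans (≋⇒∼ (⟨ F-resp {f = _ , lower} {g = _ , upper} (gen (bt₁ α)) ⟩ ∷ []))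
               (∼-sym (dword∼F₁ upper)))

  -- The other three relations of a square follow from the first by cancellation.
  bowtie⇒∼ : Bowtie C p q → word p ∼ word q
  bowtie⇒∼ (bt₁ α)    = Square.commutes α
  bowtie⇒∼ (bt₂ α)    = ∼-inverse (Square.commutes α)
  bowtie⇒∼ (bt₃ α)    = ∼-transpose (Square.commutes α)
  bowtie⇒∼ (bt₄ α)    = ∼-transpose (∼-sym (Square.commutes α))
  bowtie⇒∼ (bt-sym r) = ∼-sym (bowtie⇒∼ r)

  word-++ : ∀ {p' q'} → word p ∼ word p' → word q ∼ word q' → word (p ++ q) ∼ word (p' ++ q')
  word-++ {p} {q} {p'} {q'} r s =
    subst₂ _∼_ (sym (map-++ _ p q)) (sym (map-++ _ p' q')) (∼-++ r s)

  dihom⇒∼ : Dihom C p q → word p ∼ word q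
  dihom⇒∼ (gen r)       = bowtie⇒∼ r
  dihom⇒∼ d-refl        = ∼-refl
  dihom⇒∼ (d-sym d)     = ∼-sym (dihom⇒∼ d)
  dihom⇒∼ (d-trans d k) = ∼-trans (dihom⇒∼ d) (dihom⇒∼ k)
  dihom⇒∼ (d-cong d k)  = word-++ (dihom⇒∼ d) (dihom⇒∼ k)

  htpy⇒∼ : Htpy C p q → word p ∼ word q
  htpy⇒∼ (dih d)       = dihom⇒∼ d
  htpy⇒∼ (cancelᶠ a)   = cancelʳ
  htpy⇒∼ (cancelᵇ a)   = cancelˡ
  htpy⇒∼ h-refl        = ∼-refl
  htpy⇒∼ (h-sym h)     = ∼-sym (htpy⇒∼ h)
  htpy⇒∼ (h-trans h k) = ∼-trans (htpy⇒∼ h) (htpy⇒∼ k)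
  htpy⇒∼ (h-cong h k)  = word-++ (htpy⇒∼ h) (htpy⇒∼ k)

  eval-resp-Htpy : (hp : IsPath C x y p) (hq : IsPath C x y q) → Htpy C p q → eval hp ≈ eval hq
  eval-resp-Htpy hp hq h =
    ∼-singleton⇒≈ (∼-trans (∼-sym (word∼eval hp)) (∼-trans (htpy⇒∼ h) (word∼eval hq)))

  extension : FunctorOn (Groupoid.category (FundGpd C)) (Groupoid.category G) F₀
  extension = record
    { F₁     = λ hp → eval (proj₂ hp)
    ; F-resp = λ {_} {_} {hp} {hq} → eval-resp-Htpy (proj₂ hp) (proj₂ hq)
    ; F-id   = ≈-refl
    ; F-∘    = λ {_} {_} {_} {hp} {hq} → eval-++ (proj₂ hp) (proj₂ hq)
    }

  extension-extends : (ds : Π⃗₁.Hom x y) → eval (proj₂ (Functor.F₁ (canonical C) ds)) ≈ F₁ ds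
  extension-extends (ds , hp) = eval-dpath hp

  module _ (F' : FunctorOn (Groupoid.category (FundGpd C)) (Groupoid.category G) F₀)
           (F'-extends : ∀ {x y} (ds : Π⃗₁.Hom x y) →
                           FunctorOn.F₁ F' (Functor.F₁ (canonical C) ds) ≈ F₁ ds) where
    private
      module F' = FunctorOn F'

      step : (s : Step C) → Π₁.Hom (start C s) (end C s)
      step s = [ s ] , cons s refl nil

    -- F' preserves inverses, which pins it down on backward edges.
    extension-unique-on-steps : (s : Step C) → F'.F₁ (step s) ≈ stepHom s
    extension-unique-on-steps (fwd a) = F'-extends ([ a ] , cons a refl nil)
    extension-unique-on-steps (bwd a) =
      ≈-trans (⁻¹-unique (≈-trans (≈-sym F'.F-∘) (≈-trans (F'.F-resp (cancelᶠ a)) F'.F-id)))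
              (⁻¹-resp-≈ (extension-unique-on-steps (fwd a)))

    extension-unique : (hp : IsPath C x y p) → F'.F₁ (p , hp) ≈ eval hp
    extension-unique nil              = F'.F-id
    extension-unique (cons s refl hp) =
      ≈-trans (F'.F-∘ {f = step s}) (∘-resp-≈ (extension-unique hp) (extension-unique-on-steps s))

lemma2p5 : ∀ {o h e : Level} (C : PreCubical) (G : Groupoid o h e)
             (F : Functor (FundCat C) (Groupoid.category G)) →
           Σ (FunctorOn (Groupoid.category (FundGpd C)) (Groupoid.category G) (Functor.F₀ F))
             (λ F̃ →
                (∀ {x y} (p : Category.Hom (FundCat C) x y) →
                   Category._≈_ (Groupoid.category G)
                     (FunctorOn.F₁ F̃ (Functor.F₁ (canonical C) p)) (Functor.F₁ F p))
                ×
                (∀ (F' : FunctorOn (Groupoid.category (FundGpd C)) (Groupoid.category G) (Functor.F₀ F)) →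
                   (∀ {x y} (p : Category.Hom (FundCat C) x y) →
                      Category._≈_ (Groupoid.category G)
                        (FunctorOn.F₁ F' (Functor.F₁ (canonical C) p)) (Functor.F₁ F p)) →
                   ∀ {x y} (q : Category.Hom (Groupoid.category (FundGpd C)) x y) →
                     Category._≈_ (Groupoid.category G) (FunctorOn.F₁ F' q) (FunctorOn.F₁ F̃ q)))
lemma2p5 C G F =
  extension , extension-extends , λ F' F'-extends q → extension-unique F' F'-extends (proj₂ q)
  where open FreeExtension C G F
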